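{- Let $M\ge 1$ and $q\ge 1$ be integers, let $U=\{0,1,\ldots,M-1\}$, and let $\phi:\binom{U}{2}\to\{\alpha_1,\ldots,\alpha_q\}$ be a coloring of the pairs of $U$. Let $V=\{0,1,\ldots,2^M-1\}$. For $v\in V$ write $v=\sum_{i=0}^{M-1} v(i)2^i$ with $v(i)\in\{0,1\}$, and for $u\neq v$ in $V$ let $\delta(u,v)\in U$ be the largest $i$ with $u(i)\neq v(i)$. Define $\chi:\binom{V}{3}\to\{\alpha_1,\ldots,\alpha_q\}$ by setting, for $v_1<v_2<v_3$, $\chi(v_1,v_2,v_3)=\phi(\{\delta(v_1,v_2),\delta(v_2,v_3)\})$ (these two values are always distinct). For $m\geq 2$ set $n=2^m$. Then for any $n$ vertices $v_1<\cdots<v_n$ in $V$, there is a subset $B\subset\{\delta(v_i,v_{i+1}):1\le i\le n-1\}$ with at least $m$ distinct elements such that for each pair $\{\delta_r,\delta_s\}\in\binom{B}{2}$ there is a triple $v_i<v_j<v_k$ in $\{v_1,\ldots,v_n\}$ with $\chi(v_i,v_j,v_k)=\phi(\{\delta_r,\delta_s\})$. -}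

module Defs where

open import Data.Nat using (ℕ; zero; suc; _%_; _/_)
open import Data.Fin using (Fin; fromℕ; inject₁)
open import Data.Bool using (if_then_else_)
open import Relation.Nullary.Decidable using (⌊_⌋)
open import Data.Nat using (_≟_)
open import Data.Bool using (not)

bit : ℕ → ℕ → ℕ
bit v zero    = v % 2
bit v (suc i) = bit (v / 2) i

-- highestDiff k u v : the largest index i ≤ k with bit u i ≠ bit v i
-- (defaults to 0 if u and v agree on all bits 1..k).
highestDiff : (k : ℕ) → ℕ → ℕ → Fin (suc k)
highestDiff zero    u v = Data.Fin.zero
highestDiff (suc k) u v =
  if not ⌊ bit u (suc k) ≟ bit v (suc k) ⌋
  then fromℕ (suc k)
  else inject₁ (highestDiff k u v)

-- δ(u,v) ∈ U = {0,…,M-1} with M = suc M' : largest i < M with u(i) ≠ v(i).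
δ : (M' : ℕ) → ℕ → ℕ → Fin (suc M')
δ M' u v = highestDiff M' u v

χ : ∀ {M' q : ℕ} → (Fin (suc M') → Fin (suc M') → Fin q) → ℕ → ℕ → ℕ → Fin q
χ {M'} φ v₁ v₂ v₃ = φ (δ M' v₁ v₂) (δ M' v₂ v₃)

module Submission where

-- For terms w_lo < w_hi of the sequence let d = δ(w_lo, w_hi) be
-- their top differing bit.  All terms in between agree with w_lo above d, and their
-- bit d switches from 0 to 1 exactly once, at some cut.  Hence δ(w_a, w_b) = d for
-- every a ≤ cut < b, while all consecutive gaps δ(w_a, w_{a+1}) on either side of the
-- cut are < d.  One side contains at least half of the 2^e indices; by induction it
-- has e−1 distinct gaps pairwise realised by triples, and adding d keeps them
-- distinct and realises each new pair {b, d} by a triple straddling the cut.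

open import Defs
open import Data.Nat
open import Data.Nat.Properties
open import Data.Nat.DivMod
open import Data.Fin using (Fin; toℕ; fromℕ<)
open import Data.Fin.Properties using (toℕ-fromℕ; toℕ-inject₁; toℕ-injective; toℕ-fromℕ<)
open import Data.List using (List; []; _∷_; length)
open import Data.List.Membership.Propositional using (_∈_)
open import Data.List.Relation.Unary.Any using (here; there)
import Data.List.Relation.Unary.All as All
open import Data.List.Relation.Unary.Unique.Propositional using (Unique)
import Data.List.Relation.Unary.AllPairs.Core as AP
open import Data.Product using (∃; _×_; _,_; proj₁; proj₂; Σ-syntax)
open import Data.Sum using (inj₁; inj₂)
open import Data.Empty using (⊥-elim)
open import Relation.Nullary using (¬_; yes; no)
open import Relation.Binary.PropositionalEquality
open import Function using (_∘_)

high : ℕ → ℕ → ℕ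
high x zero    = x
high x (suc k) = high (x / 2) k

bit≡high%2 : ∀ x k → bit x k ≡ high x k % 2
bit≡high%2 x zero    = refl
bit≡high%2 x (suc k) = bit≡high%2 (x / 2) k

high-suc : ∀ x k → high x (suc k) ≡ high x k / 2
high-suc x zero    = refl
high-suc x (suc k) = high-suc (x / 2) k

high-split : ∀ x k → high x k ≡ bit x k + high x (suc k) * 2
high-split x k rewrite bit≡high%2 x k | high-suc x k = m≡m%n+[m/n]*n (high x k) 2

high-mono : ∀ {x y} k → x ≤ y → high x k ≤ high y k
high-mono zero    x≤y = x≤y
high-mono (suc k) x≤y = high-mono k (/-mono-≤ x≤y ≤-refl)

high-small : ∀ x k → x < 2 ^ k → high x k ≡ 0
high-small x zero    x<1 = n<1⇒n≡0 x<1
high-small x (suc k) x<2^k+1 =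
  high-small (x / 2) k (m<n*o⇒m/o<n (subst (x <_) (*-comm 2 (2 ^ k)) x<2^k+1))

high-agree-≤ : ∀ {x y k l} → k ≤ l → high x k ≡ high y k → high x l ≡ high y l
high-agree-≤ {x} {y} {l = zero} z≤n e = e
high-agree-≤ {x} {y} {l = suc l} k≤l+1 e with m≤n⇒m<n∨m≡n k≤l+1
... | inj₂ refl      = e
... | inj₁ (s≤s k≤l) rewrite high-suc x l | high-suc y l = cong (_/ 2) (high-agree-≤ k≤l e)

high-convex : ∀ {u x v} k → u ≤ x → x ≤ v → high u k ≡ high v k → high x k ≡ high u k
high-convex k u≤x x≤v e = ≤-antisym (subst (_ ≤_) (sym e) (high-mono k x≤v)) (high-mono k u≤x)

half-close : ∀ a b → a / 2 ≡ b / 2 → b ≤ suc a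
half-close a b e = begin
  b                  ≡⟨ m≡m%n+[m/n]*n b 2 ⟩
  b % 2 + b / 2 * 2  ≤⟨ +-monoˡ-≤ (b / 2 * 2) (s≤s⁻¹ (m%n<n b 2)) ⟩
  suc (b / 2 * 2)    ≡⟨ cong (λ t → suc (t * 2)) (sym e) ⟩
  suc (a / 2 * 2)    ≤⟨ s≤s (m/n*n≤m a 2) ⟩
  suc a              ∎
  where open ≤-Reasoning

TopDiff : ℕ → ℕ → ℕ → Set
TopDiff u v d = high u (suc d) ≡ high v (suc d) × high u d ≢ high v d

topDiff-bit : ∀ {u v d} → TopDiff u v d → bit u d ≢ bit v d
topDiff-bit {u} {v} {d} (above , differ) same = differ (begin
  high u d                     ≡⟨ high-split u d ⟩
  bit u d + high u (suc d) * 2 ≡⟨ cong₂ (λ b h → b + h * 2) same above ⟩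
  bit v d + high v (suc d) * 2 ≡⟨ high-split v d ⟨
  high v d                     ∎)
  where open ≡-Reasoning

highestDiff-topDiff : ∀ {u v d} k → d ≤ k → TopDiff u v d → toℕ (highestDiff k u v) ≡ d
highestDiff-topDiff zero z≤n _ = refl
highestDiff-topDiff {u} {v} {d} (suc k) d≤k+1 td
  with m≤n⇒m<n∨m≡n d≤k+1 | bit u (suc k) ≟ bit v (suc k)
... | inj₂ refl      | yes same = ⊥-elim (topDiff-bit {u} {v} {suc k} td same)
... | inj₂ refl      | no _     = toℕ-fromℕ (suc k)
... | inj₁ (s≤s d≤k) | yes _    = trans (toℕ-inject₁ (highestDiff k u v)) (highestDiff-topDiff k d≤k td)
... | inj₁ (s≤s d≤k) | no differ = ⊥-elim (differ (begin
  bit u (suc k)        ≡⟨ bit≡high%2 u (suc k) ⟩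
  high u (suc k) % 2   ≡⟨ cong (_% 2) (high-agree-≤ {u} {v} (s≤s d≤k) (proj₁ td)) ⟩
  high v (suc k) % 2   ≡⟨ bit≡high%2 v (suc k) ⟨
  bit v (suc k)        ∎))
  where open ≡-Reasoning

topDiff-exists : ∀ u v K → u ≢ v → high u K ≡ high v K → ∃ λ d → d < K × TopDiff u v d
topDiff-exists u v zero    u≢v e = ⊥-elim (u≢v e)
topDiff-exists u v (suc K) u≢v e with high u K ≟ high v K
... | no differ = K , ≤-refl , e , differ
... | yes e′ with topDiff-exists u v K u≢v e′
...   | d , d<K , td = d , m≤n⇒m≤1+n d<K , td

StepsAt : (ℕ → ℕ) → ℕ → ℕ → ℕ → Set
StepsAt f lo hi i = lo ≤ i × i < hi × (∀ {j} → lo ≤ j → j ≤ i → f j ≡ f lo)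
                                    × (∀ {j} → i < j → j ≤ hi → f j ≡ f hi)

single-step : (f : ℕ → ℕ) {lo hi : ℕ} → lo < hi →
  (∀ {a b} → lo ≤ a → a ≤ b → b ≤ hi → f a ≤ f b) →
  f lo < f hi → f hi ≤ suc (f lo) → ∃ (StepsAt f lo hi)
single-step f {lo} {suc h} (s≤s lo≤h) f-mono rise small with f h ≟ f lo
... | yes flat = h , lo≤h , ≤-refl , left , last
  where
  left : ∀ {j} → lo ≤ j → j ≤ h → f j ≡ f lo
  left {j} lo≤j j≤h = ≤-antisym (subst (f j ≤_) flat (f-mono lo≤j j≤h (n≤1+n h)))
                                (f-mono ≤-refl lo≤j (m≤n⇒m≤1+n j≤h))
  last : ∀ {j} → h < j → j ≤ suc h → f j ≡ f (suc h)
  last h<j j≤h+1 = cong f (≤-antisym j≤h+1 h<j)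
... | no jumped = extend-step (single-step f lo<h f-mono′
                                 (subst (f lo <_) (sym fh≡fhi) rise) (subst (_≤ suc (f lo)) (sym fh≡fhi) small))
  where
  lo<h : lo < h
  lo<h = ≤∧≢⇒< lo≤h (λ { refl → jumped refl })
  f-mono′ : ∀ {a b} → lo ≤ a → a ≤ b → b ≤ h → f a ≤ f b
  f-mono′ lo≤a a≤b b≤h = f-mono lo≤a a≤b (m≤n⇒m≤1+n b≤h)
  -- f h already differs from f lo, so it has reached f (suc h)
  fh≡fhi : f h ≡ f (suc h)
  fh≡fhi = ≤-antisym (f-mono lo≤h (n≤1+n h) ≤-refl)
    (≤-trans small (≤∧≢⇒< (f-mono ≤-refl lo≤h (n≤1+n h)) (λ e → jumped (sym e))))
  extend-step : ∃ (StepsAt f lo h) → ∃ (StepsAt f lo (suc h))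
  extend-step (i , lo≤i , i<h , left , right) = i , lo≤i , m≤n⇒m≤1+n i<h , left , right′
    where
    right′ : ∀ {j} → i < j → j ≤ suc h → f j ≡ f (suc h)
    right′ {j} i<j j≤h+1 with m≤n⇒m<n∨m≡n j≤h+1
    ... | inj₁ (s≤s j≤h) = trans (right i<j j≤h) fh≡fhi
    ... | inj₂ refl      = refl

large-interval : ∀ e {lo hi} → lo + 2 ^ suc e ≤ suc hi → lo < hi
large-interval e {lo} size = s≤s⁻¹ (≤-trans (≤-reflexive (+-comm 2 lo)) (≤-trans two≤ size))
  where
  two≤ : lo + 2 ≤ lo + 2 ^ suc e
  two≤ = +-monoʳ-≤ lo (*-monoʳ-≤ 2 (m^n>0 2 e))

right-half-large : ∀ e {lo c hi} → ¬ (lo + 2 ^ e ≤ suc c) → lo + 2 ^ suc e ≤ suc hi → suc c + 2 ^ e ≤ suc hi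
right-half-large e {lo} {c} {hi} leftSmall size = begin
  suc c + 2 ^ e          ≤⟨ +-monoˡ-≤ (2 ^ e) (<⇒≤ (≰⇒> leftSmall)) ⟩
  lo + 2 ^ e + 2 ^ e     ≡⟨ +-assoc lo (2 ^ e) (2 ^ e) ⟩
  lo + (2 ^ e + 2 ^ e)   ≡⟨ cong (λ t → lo + (2 ^ e + t)) (sym (+-identityʳ (2 ^ e))) ⟩
  lo + 2 ^ suc e         ≤⟨ size ⟩
  suc hi                 ∎
  where open ≤-Reasoning

-- The argument for a strictly increasing sequence w₀ < w₁ < … < w_{N-1} of numbers
-- below 2^M, indexed by ℕ (only indices below N matter).
module Sequence (M' : ℕ) {q : ℕ} (φ : Fin (suc M') → Fin (suc M') → Fin q)
                (φ-sym : ∀ a b → φ a b ≡ φ b a) (w : ℕ → ℕ) (N : ℕ)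
                (w-bounded : ∀ a → w a < 2 ^ suc M')
                (w-increasing : ∀ {a b} → a < b → b < N → w a < w b) where

  w-mono : ∀ {a b} → a ≤ b → b < N → w a ≤ w b
  w-mono a≤b b<N with m≤n⇒m<n∨m≡n a≤b
  ... | inj₁ a<b  = <⇒≤ (w-increasing a<b b<N)
  ... | inj₂ refl = ≤-refl

  topDiff-of : ∀ {a b} → a < b → b < N → ∃ λ d → d ≤ M' × TopDiff (w a) (w b) d
  topDiff-of {a} {b} a<b b<N
    with topDiff-exists (w a) (w b) (suc M') (<⇒≢ (w-increasing a<b b<N))
           (trans (high-small (w a) (suc M') (w-bounded a)) (sym (high-small (w b) (suc M') (w-bounded b))))
  ... | d , s≤s d≤M' , td = d , d≤M' , td

  δ-below : ∀ {a b} D → a < b → b < N → high (w a) D ≡ high (w b) D → toℕ (δ M' (w a) (w b)) < D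
  δ-below {a} {b} D a<b b<N agree with topDiff-of a<b b<N
  ... | d , d≤M' , td with D ≤? d
  ...   | yes D≤d = ⊥-elim (proj₂ td (high-agree-≤ {w a} {w b} D≤d agree))
  ...   | no D≰d  = subst (_< D) (sym (highestDiff-topDiff M' d≤M' td)) (≰⇒> D≰d)

  Gap : ℕ → ℕ → Fin (suc M') → Set
  Gap lo hi b = ∃ λ a → lo ≤ a × suc a ≤ hi × b ≡ δ M' (w a) (w (suc a))

  gap-widen : ∀ {lo hi lo′ hi′ b} → lo ≤ lo′ → hi′ ≤ hi → Gap lo′ hi′ b → Gap lo hi b
  gap-widen lo≤lo′ hi′≤hi (a , lo′≤a , a<hi′ , e) = a , ≤-trans lo≤lo′ lo′≤a , ≤-trans a<hi′ hi′≤hi , e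

  Realised : Fin q → Set
  Realised c = ∃ λ i → ∃ λ j → ∃ λ k → i < j × j < k × k < N × χ φ (w i) (w j) (w k) ≡ c

  record Good (lo hi e : ℕ) : Set where
    field
      gaps     : List (Fin (suc M'))
      unique   : Unique gaps
      large    : e ≤ length gaps
      are-gaps : ∀ {b} → b ∈ gaps → Gap lo hi b
      realised : ∀ {r s} → r ∈ gaps → s ∈ gaps → r ≢ s → Realised (φ r s)

  top : ℕ → ℕ → Fin (suc M')
  top lo hi = δ M' (w lo) (w hi)

  -- [lo, hi] splits at a cut into the terms whose bit at level top lo hi is 0
  -- and those where it is 1; every pair across the cut is separated there, and
  -- all gaps on either side are strictly lower.
  record Split (lo hi : ℕ) : Set where
    field
      cut       : ℕ
      lo≤cut    : lo ≤ cut
      cut<hi    : cut < hi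
      across    : ∀ {a b} → lo ≤ a → a ≤ cut → cut < b → b ≤ hi → δ M' (w a) (w b) ≡ top lo hi
      left-low  : ∀ {b} → Gap lo cut b → toℕ b < toℕ (top lo hi)
      right-low : ∀ {b} → Gap (suc cut) hi b → toℕ b < toℕ (top lo hi)

  -- At level d = top lo hi the terms agree above d, and f j = ⌊w_j / 2^d⌋ rises by
  -- exactly one over [lo, hi]; the cut is where it steps.
  split : ∀ {lo hi} → lo < hi → hi < N → Split lo hi
  split {lo} {hi} lo<hi hi<N with topDiff-of lo<hi hi<N
  ... | d , d≤M' , above , differ = split-at-step (single-step f lo<hi f-mono rise small)
    where
    f : ℕ → ℕ
    f j = high (w j) d
    f-mono : ∀ {a b} → lo ≤ a → a ≤ b → b ≤ hi → f a ≤ f b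
    f-mono _ a≤b b≤hi = high-mono d (w-mono a≤b (≤-<-trans b≤hi hi<N))
    rise : f lo < f hi
    rise = ≤∧≢⇒< (f-mono ≤-refl (<⇒≤ lo<hi) ≤-refl) differ
    small : f hi ≤ suc (f lo)
    small = half-close (f lo) (f hi)
      (trans (sym (high-suc (w lo) d)) (trans above (high-suc (w hi) d)))
    top≡d : toℕ (top lo hi) ≡ d
    top≡d = highestDiff-topDiff M' d≤M' (above , differ)
    same-above : ∀ {j} → lo ≤ j → j ≤ hi → high (w j) (suc d) ≡ high (w lo) (suc d)
    same-above lo≤j j≤hi = high-convex (suc d) (w-mono lo≤j (≤-<-trans j≤hi hi<N)) (w-mono j≤hi hi<N) above
    gap-below : ∀ {a} → suc a < N → f a ≡ f (suc a) → toℕ (δ M' (w a) (w (suc a))) < toℕ (top lo hi)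
    gap-below a+1<N same = subst (_ <_) (sym top≡d) (δ-below d ≤-refl a+1<N same)
    split-at-step : ∃ (StepsAt f lo hi) → Split lo hi
    split-at-step (cut , lo≤cut , cut<hi , left , right) = record
      { cut = cut ; lo≤cut = lo≤cut ; cut<hi = cut<hi
      ; across = across ; left-low = left-low ; right-low = right-low }
      where
      across : ∀ {a b} → lo ≤ a → a ≤ cut → cut < b → b ≤ hi → δ M' (w a) (w b) ≡ top lo hi
      across lo≤a a≤cut cut<b b≤hi = toℕ-injective (trans (highestDiff-topDiff M' d≤M' top-at-d) (sym top≡d))
        where
        lo≤b = ≤-trans lo≤cut (<⇒≤ cut<b)
        top-at-d = trans (same-above lo≤a (≤-trans a≤cut (<⇒≤ cut<hi))) (sym (same-above lo≤b b≤hi))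
                 , λ e → differ (trans (sym (left lo≤a a≤cut)) (trans e (right cut<b b≤hi)))
      left-low : ∀ {b} → Gap lo cut b → toℕ b < toℕ (top lo hi)
      left-low (a , lo≤a , a<cut , refl) = gap-below (≤-<-trans a<cut (<-trans cut<hi hi<N))
        (trans (left lo≤a (<⇒≤ a<cut)) (sym (left (m≤n⇒m≤1+n lo≤a) a<cut)))
      right-low : ∀ {b} → Gap (suc cut) hi b → toℕ b < toℕ (top lo hi)
      right-low (a , cut<a , a<hi , refl) = gap-below (≤-<-trans a<hi hi<N)
        (trans (right cut<a (<⇒≤ a<hi)) (sym (right (m≤n⇒m≤1+n cut<a) a<hi)))

  module _ {lo hi} (hi<N : hi < N) (S : Split lo hi) where
    open Split S

    top-is-gap : Gap lo hi (top lo hi)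
    top-is-gap = cut , lo≤cut , cut<hi , sym (across lo≤cut ≤-refl ≤-refl cut<hi)

    left-realised : ∀ {b} → Gap lo cut b → Realised (φ b (top lo hi))
    left-realised (a , lo≤a , a<cut , refl) =
      a , suc a , suc cut , ≤-refl , s≤s a<cut , ≤-<-trans cut<hi hi<N ,
      cong (φ _) (across (m≤n⇒m≤1+n lo≤a) a<cut ≤-refl cut<hi)

    right-realised : ∀ {b} → Gap (suc cut) hi b → Realised (φ b (top lo hi))
    right-realised (a , cut<a , a<hi , refl) =
      cut , a , suc a , cut<a , ≤-refl , ≤-<-trans a<hi hi<N ,
      trans (cong (λ t → φ t _) (across lo≤cut ≤-refl cut<a (<⇒≤ a<hi))) (φ-sym _ _)

  extend : ∀ {lo hi lo′ hi′ e} (d : Fin (suc M')) → Gap lo hi d → lo ≤ lo′ → hi′ ≤ hi →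
           (∀ {b} → Gap lo′ hi′ b → toℕ b < toℕ d) →
           (∀ {b} → Gap lo′ hi′ b → Realised (φ b d)) →
           Good lo′ hi′ e → Good lo hi (suc e)
  extend d d-gap lo≤lo′ hi′≤hi below with-d G = record
    { gaps = d ∷ gaps ; unique = All.tabulate d∉gaps AP.∷ unique ; large = s≤s large
    ; are-gaps = λ { (here refl) → d-gap ; (there b∈) → gap-widen lo≤lo′ hi′≤hi (are-gaps b∈) }
    ; realised = pairs }
    where
    open Good G
    d∉gaps : ∀ {b} → b ∈ gaps → d ≢ b
    d∉gaps b∈ refl = <-irrefl refl (below (are-gaps b∈))
    pairs : ∀ {r s} → r ∈ d ∷ gaps → s ∈ d ∷ gaps → r ≢ s → Realised (φ r s)
    pairs (here refl) (here refl) r≢s = ⊥-elim (r≢s refl)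
    pairs (here refl) (there s∈)  _   = subst Realised (φ-sym _ _) (with-d (are-gaps s∈))
    pairs (there r∈)  (here refl) _   = with-d (are-gaps r∈)
    pairs (there r∈)  (there s∈)  r≢s = realised r∈ s∈ r≢s

  -- Every interval with at least 2^e points is good for e: split it and recurse
  -- into a half that still has 2^(e-1) points.
  good : ∀ e {lo hi} → hi < N → lo + 2 ^ e ≤ suc hi → Good lo hi e
  good zero _ _ = record { gaps = [] ; unique = AP.[] ; large = z≤n ; are-gaps = λ () ; realised = λ () }
  good (suc e) {lo} {hi} hi<N size with split (large-interval e size) hi<N
  ... | S with lo + 2 ^ e ≤? suc (Split.cut S)
  ...   | yes left-large = extend (top lo hi) (top-is-gap hi<N S) ≤-refl (<⇒≤ cut<hi) left-low
            (left-realised hi<N S) (good e (<-trans cut<hi hi<N) left-large)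
    where open Split S
  ...   | no left-small = extend (top lo hi) (top-is-gap hi<N S) (m≤n⇒m≤1+n lo≤cut) ≤-refl right-low
            (right-realised hi<N S) (good e hi<N (right-half-large e left-small size))
    where open Split S

pad : ∀ {N} → (Fin N → ℕ) → ℕ → ℕ
pad {N} v a with a <? N
... | yes a<N = v (fromℕ< a<N)
... | no _    = 0

pad-fromℕ< : ∀ {N} (v : Fin N → ℕ) {a} (a<N : a < N) → pad v a ≡ v (fromℕ< a<N)
pad-fromℕ< {N} v {a} a<N with a <? N
... | yes _   = refl
... | no a≮N = ⊥-elim (a≮N a<N)

module FinIndexed (M' : ℕ) {q : ℕ} (φ : Fin (suc M') → Fin (suc M') → Fin q)
                  (φ-sym : ∀ a b → φ a b ≡ φ b a) {N : ℕ} (v : Fin N → ℕ)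
                  (v-bounded : ∀ i → v i < 2 ^ suc M')
                  (v-increasing : ∀ i j → toℕ i < toℕ j → v i < v j) where

  at : ∀ {a} (a<N : a < N) → pad v a ≡ v (fromℕ< a<N)
  at = pad-fromℕ< v

  fin< : ∀ {a b} (a<N : a < N) (b<N : b < N) → a < b → toℕ (fromℕ< a<N) < toℕ (fromℕ< b<N)
  fin< a<N b<N = subst₂ _<_ (sym (toℕ-fromℕ< a<N)) (sym (toℕ-fromℕ< b<N))

  pad-bounded : ∀ a → pad v a < 2 ^ suc M'
  pad-bounded a with a <? N
  ... | yes a<N = v-bounded (fromℕ< a<N)
  ... | no _    = m^n>0 2 (suc M')

  pad-increasing : ∀ {a b} → a < b → b < N → pad v a < pad v b
  pad-increasing a<b b<N = let a<N = <-trans a<b b<N in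
    subst₂ _<_ (sym (at a<N)) (sym (at b<N)) (v-increasing _ _ (fin< a<N b<N a<b))

  open Sequence M' φ φ-sym (pad v) N pad-bounded pad-increasing public

  gap⇒fin : ∀ {lo hi b} → hi < N → Gap lo hi b →
            ∃ λ (i : Fin N) → ∃ λ (j : Fin N) → toℕ j ≡ suc (toℕ i) × b ≡ δ M' (v i) (v j)
  gap⇒fin hi<N (a , _ , a<hi , b≡) =
    fromℕ< a<N , fromℕ< a+1<N , trans (toℕ-fromℕ< a+1<N) (cong suc (sym (toℕ-fromℕ< a<N))) ,
    trans b≡ (cong₂ (δ M') (at a<N) (at a+1<N))
    where
    a+1<N = ≤-<-trans a<hi hi<N
    a<N = <-trans ≤-refl a+1<N

  realised⇒fin : ∀ {c} → Realised c → ∃ λ (i : Fin N) → ∃ λ (j : Fin N) → ∃ λ (k : Fin N) →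
                 toℕ i < toℕ j × toℕ j < toℕ k × χ φ (v i) (v j) (v k) ≡ c
  realised⇒fin (i , j , k , i<j , j<k , k<N , χ≡) =
    fromℕ< i<N , fromℕ< j<N , fromℕ< k<N , fin< i<N j<N i<j , fin< j<N k<N j<k ,
    trans (sym (cong₃ (χ φ) (at i<N) (at j<N) (at k<N))) χ≡
    where
    j<N = <-trans j<k k<N
    i<N = <-trans i<j j<N
    cong₃ : ∀ (g : ℕ → ℕ → ℕ → Fin q) {x x′ y y′ z z′} → x ≡ x′ → y ≡ y′ → z ≡ z′ → g x y z ≡ g x′ y′ z′
    cong₃ g refl refl refl = refl

lemma2p2 : (M' q : ℕ) → 1 ≤ q →
           (φ : Fin (suc M') → Fin (suc M') → Fin q) → (∀ a b → φ a b ≡ φ b a) →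
           (m : ℕ) → 2 ≤ m →
           (v : Fin (2 ^ m) → ℕ) →
           (∀ i → v i < 2 ^ suc M') →
           (∀ i j → toℕ i < toℕ j → v i < v j) →
           Σ[ B ∈ List (Fin (suc M')) ]
             Unique B × m ≤ length B ×
             (∀ {b} → b ∈ B → ∃ λ (i : Fin (2 ^ m)) → ∃ λ (j : Fin (2 ^ m)) →
                toℕ j ≡ suc (toℕ i) × b ≡ δ M' (v i) (v j)) ×
             (∀ {r s} → r ∈ B → s ∈ B → r ≢ s →
                ∃ λ (i : Fin (2 ^ m)) → ∃ λ (j : Fin (2 ^ m)) → ∃ λ (k : Fin (2 ^ m)) →
                  toℕ i < toℕ j × toℕ j < toℕ k × χ φ (v i) (v j) (v k) ≡ φ r s)
lemma2p2 M' q _ φ φ-sym m _ v v-bounded v-increasing =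
  gaps , unique , large , gap⇒fin last<N ∘ are-gaps , λ r∈ s∈ r≢s → realised⇒fin (realised r∈ s∈ r≢s)
  where
  open FinIndexed M' φ φ-sym v v-bounded v-increasing
  whole : suc (pred (2 ^ m)) ≡ 2 ^ m
  whole = suc-pred (2 ^ m) {{m^n≢0 2 m}}
  last<N : pred (2 ^ m) < 2 ^ m
  last<N = ≤-reflexive whole
  open Good (good m last<N (≤-reflexive (sym whole)))
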